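{- Let $G$ be a 3-tree, and suppose that $G$ has a branch $B=B(\{v_1,v_2,v_3\},u_0)$ which is an ear, a one-hat, or a one-hat plus of $G$ (with the labelling of vertices as in the definitions of these branches). Let $G'=G-(V(B)\setminus\{v_1,v_2,v_3\})$ and suppose that $G'$ admits an odd 5-coloring $\varphi'$. Then for any index $i\in\{1,2,3\}$, $\varphi'$ can be extended to a proper 5-coloring of $G$ such that every vertex of $V(G)\setminus\{v_i,v_{i+1}\}$ satisfies the odd condition, where $v_4=v_1$. Moreover, when $B$ is a one-hat or a one-hat plus, then for any index $i\in\{1,2,3\}$, $\varphi'$ can be extended to a proper 5-coloring of $G$ such that every vertex of $V(G)\setminus\{v_i\}$ satisfies the odd condition.
   Context: A graph $G$ is a 3-tree if it can be built from $K_4$ by repeatedly adding a new vertex adjacent to exactly the three vertices of an existing triangle. A proper 5-coloring is a map $\varphi:V(G)\to\{1,\dots,5\}$ with adjacent vertices receiving different colors; a vertex $v$ satisfies the odd condition with respect to $\varphi$ if $|\varphi^{ -1}(j)\cap N_G(v)|$ is odd for some color $j$; an odd 5-coloring is a proper 5-coloring in which every non-isolated vertex satisfies the odd condition. For a triangle $V$ and a vertex $u$ adjacent to all of $V$, the branch $B(V,u)$ is the subgraph induced by $V\cup V(G_u)$ where $G_u$ is the component of $G-V$ containing $u$. An ear is a branch $B(\{v_1,v_2,v_3\},u_0)$ with vertex set $\{v_1,v_2,v_3,u_0\}$ and $N_G(u_0)=\{v_1,v_2,v_3\}$. A one-hat is a branch $B(\{v_1,v_2,v_3\},u_0)$ with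 vertex set $\{v_1,v_2,v_3,u_0,u_1\}$ such that $N_G(u_0)=\{v_1,v_2,v_3,u_1\}$ and $N_G(u_1)=\{v_1,v_2,u_0\}$. A one-hat plus is a branch $B(\{v_1,v_2,v_3\},u_0)$ with vertex set $\{v_1,v_2,v_3,u_0,u_1,u_2,u_3\}$ such that $N_G(u_0)=\{v_1,v_2,v_3,u_1,u_2,u_3\}$, $N_G(u_1)=\{v_1,v_2,u_0,u_3\}$, $N_G(u_2)=\{v_2,v_3,u_0\}$, $N_G(u_3)=\{v_1,u_0,u_1\}$. -}

module Defs where

open import Data.Nat using (ℕ; zero; suc; _+_; _%_)
open import Data.Bool using (Bool; true; false; not; _∧_; _∨_; if_then_else_)
open import Data.Fin using (Fin; zero; suc; _≟_)
open import Data.Fin.Permutation using (Permutation′; _⟨$⟩ʳ_)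
open import Data.List using (List; []; _∷_)
open import Data.List.Membership.Propositional using (_∈_)
open import Data.List.Relation.Unary.Unique.Propositional using (Unique)
open import Data.Product using (Σ; ∃; _×_; _,_)
open import Relation.Binary.PropositionalEquality using (_≡_; _≢_)
open import Relation.Nullary.Decidable using (⌊_⌋)
open import Function.Bundles using (_⇔_)

Adj : ℕ → Set
Adj n = Fin n → Fin n → Bool

inList : ∀ {n} → Fin n → List (Fin n) → Bool
inList x []       = false
inList x (y ∷ ys) = ⌊ x ≟ y ⌋ ∨ inList x ys

count : ∀ {n} → (Fin n → Bool) → ℕ
count {zero}  p = 0
count {suc n} p = (if p zero then 1 else 0) + count (λ i → p (suc i))

K4 : Adj 4
K4 i j = not ⌊ i ≟ j ⌋

-- Add a new vertex (the new vertex is `zero`, old vertex i becomes `suc i`)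
-- adjacent to exactly a, b, c.
extend : ∀ {n} → Adj n → Fin n → Fin n → Fin n → Adj (suc n)
extend A a b c zero    zero    = false
extend A a b c zero    (suc j) = ⌊ j ≟ a ⌋ ∨ ⌊ j ≟ b ⌋ ∨ ⌊ j ≟ c ⌋
extend A a b c (suc i) zero    = ⌊ i ≟ a ⌋ ∨ ⌊ i ≟ b ⌋ ∨ ⌊ i ≟ c ⌋
extend A a b c (suc i) (suc j) = A i j

-- Graphs (up to isomorphism) obtained from K4 by repeatedly adding a vertex
-- adjacent to exactly the three vertices of an existing triangle.
data IsThreeTree : (n : ℕ) → Adj n → Set where
  base    : IsThreeTree 4 K4
  add     : ∀ {n A} → IsThreeTree n A → (a b c : Fin n) →
            A a b ≡ true → A b c ≡ true → A a c ≡ true →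
            IsThreeTree (suc n) (extend A a b c)
  relabel : ∀ {n A B} → IsThreeTree n A → (σ : Permutation′ n) →
            (∀ i j → B i j ≡ A (σ ⟨$⟩ʳ i) (σ ⟨$⟩ʳ j)) → IsThreeTree n B

-- Colorings.  A subgraph is given by a vertex predicate S (induced subgraph).

Coloring : ℕ → Set
Coloring n = Fin n → Fin 5

Proper : ∀ {n} → Adj n → (Fin n → Bool) → Coloring n → Set
Proper A S φ = ∀ x y → S x ≡ true → S y ≡ true → A x y ≡ true → φ x ≢ φ y

nbColorCount : ∀ {n} → Adj n → (Fin n → Bool) → Coloring n → Fin n → Fin 5 → ℕ
nbColorCount A S φ x j = count (λ w → A x w ∧ S w ∧ ⌊ φ w ≟ j ⌋)

OddAt : ∀ {n} → Adj n → (Fin n → Bool) → Coloring n → Fin n → Set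
OddAt A S φ x = ∃ λ (j : Fin 5) → nbColorCount A S φ x j % 2 ≡ 1

NonIsolated : ∀ {n} → Adj n → (Fin n → Bool) → Fin n → Set
NonIsolated A S x = ∃ λ w → S w ≡ true × A x w ≡ true

OddColoring : ∀ {n} → Adj n → (Fin n → Bool) → Coloring n → Set
OddColoring A S φ =
  Proper A S φ × (∀ x → S x ≡ true → NonIsolated A S x → OddAt A S φ x)

allV : ∀ {n} → Fin n → Bool
allV _ = true

-- Reach A D x y : y is reachable from x in G - D (D = deleted vertices)
data Reach {n} (A : Adj n) (D : Fin n → Bool) : Fin n → Fin n → Set where
  here : ∀ {x} → Reach A D x x
  step : ∀ {x y z} → Reach A D x y → A y z ≡ true → D z ≡ false → Reach A D x z

Nbhd : ∀ {n} → Adj n → Fin n → List (Fin n) → Set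
Nbhd A x L = ∀ w → (A x w ≡ true) ⇔ (w ∈ L)

triList : ∀ {n} → (Fin 3 → Fin n) → List (Fin n)
triList v = v zero ∷ v (suc zero) ∷ v (suc (suc zero)) ∷ []

-- B(V, u0) is a branch whose vertex set is V ∪ {u0} ∪ rest, V = {v 0, v 1, v 2},
-- with all these listed vertices distinct.
record IsBranch {n} (A : Adj n) (v : Fin 3 → Fin n) (u0 : Fin n)
                (rest : List (Fin n)) : Set where
  field
    triangle  : ∀ i j → i ≢ j → A (v i) (v j) ≡ true
    distinct  : Unique (v zero ∷ v (suc zero) ∷ v (suc (suc zero)) ∷ u0 ∷ rest)
    u0-adj    : ∀ i → A u0 (v i) ≡ true
    component : ∀ w → Reach A (λ x → inList x (triList v)) u0 w ⇔ (w ∈ u0 ∷ rest)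

data Kind : Set where
  ear oneHat oneHatPlus : Kind

-- shape of the branch (v1,v2,v3 = v 0, v 1, v 2)
data Shape {n} (A : Adj n) (v : Fin 3 → Fin n) (u0 : Fin n) :
           List (Fin n) → Kind → Set where
  isEar        : Nbhd A u0 (triList v) → Shape A v u0 [] ear
  isOneHat     : ∀ u1 →
                 Nbhd A u0 (v zero ∷ v (suc zero) ∷ v (suc (suc zero)) ∷ u1 ∷ []) →
                 Nbhd A u1 (v zero ∷ v (suc zero) ∷ u0 ∷ []) →
                 Shape A v u0 (u1 ∷ []) oneHat
  isOneHatPlus : ∀ u1 u2 u3 →
                 Nbhd A u0 (v zero ∷ v (suc zero) ∷ v (suc (suc zero)) ∷ u1 ∷ u2 ∷ u3 ∷ []) →
                 Nbhd A u1 (v zero ∷ v (suc zero) ∷ u0 ∷ u3 ∷ []) →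
                 Nbhd A u2 (v (suc zero) ∷ v (suc (suc zero)) ∷ u0 ∷ []) →
                 Nbhd A u3 (v zero ∷ u0 ∷ u1 ∷ []) →
                 Shape A v u0 (u1 ∷ u2 ∷ u3 ∷ []) oneHatPlus

next : Fin 3 → Fin 3
next zero             = suc zero
next (suc zero)       = suc (suc zero)
next (suc (suc zero)) = zero

Extends : ∀ {n} → (Fin n → Bool) → Coloring n → Coloring n → Set
Extends S φ' φ = ∀ x → S x ≡ true → φ x ≡ φ' x

{-# OPTIONS --safe #-}
-- Keep φ′ off the branch and colour only its vertices u₀, u₁, ….  The branch is a component
-- of G − {v₁, v₂, v₃}, so a vertex off the branch and its triangle gains no neighbours and stays
-- odd, while a branch vertex sees only the triangle and the branch: its conditions are finite
-- facts about the triangle colours a, b, c and the chosen colours.  A triangle vertex vₖ gains,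
-- for each colour j, its branch neighbours coloured j; if two choices differ in the parity of
-- that number for some j, one of them makes vₖ odd.  With d, e the two colours missing on the
-- triangle, explicit admissible choices from a, …, e that pairwise differ in this way do the
-- job: two of them fix one triangle vertex (ear) and three fix any two (one-hat plus, and a
-- one-hat for v₁, v₂); in a one-hat v₃ sees only u₀, so u₀'s colour is chosen for v₃ and u₁'s
-- for the other vertex.  The finite facts are decided by evaluation over all colour triples.
module Submission where

open import Defs
open import Data.Bool using (Bool; true; false; not; _∧_; _∨_; if_then_else_)
open import Data.Bool.Properties using (∧-zeroʳ; not-injective)
open import Data.Empty using (⊥-elim)
open import Data.Fin using (Fin; zero; suc; _≟_; _↑ˡ_; _↑ʳ_)
open import Data.Fin.Properties using (suc-injective)
import Data.Fin.Properties as Fin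
open import Data.Fin.Patterns using (0F; 1F; 2F; 3F; 4F; 5F; 6F)
open import Data.Fin.Permutation using (_⟨$⟩ʳ_; _⟨$⟩ˡ_; inverseʳ)
open import Data.List using (List; []; _∷_; map; length; lookup; tabulate; allFin; foldr)
open import Data.List.Properties using (tabulate-lookup; map-tabulate)
open import Data.List.Membership.Propositional using (_∈_; _∉_)
open import Data.List.Membership.Propositional.Properties using (∈-lookup; ∈-map⁻)
open import Data.List.Relation.Unary.Any using (here; there; index)
open import Data.List.Relation.Unary.Any.Properties using (lookup-index)
open import Data.List.Relation.Unary.All using (All)
import Data.List.Relation.Unary.All as All
open import Data.List.Relation.Unary.All.Properties using (All¬⇒¬Any)
open import Data.List.Relation.Unary.AllPairs using (_∷_)
import Data.List.Relation.Unary.AllPairs as AllPairs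
open import Data.List.Relation.Unary.Unique.Propositional using (Unique)
import Data.List.Relation.Unary.Unique.Propositional.Properties as Unique
open import Data.Vec using (Vec; _∷_; [])
import Data.Vec as Vec
open import Data.Nat using (ℕ; zero; suc; _+_; _%_; parity)
open import Data.Nat.Properties using (+-identityʳ; +-suc; +-comm)
open import Data.Parity.Base using (0ℙ; 1ℙ)
import Data.Parity.Base as ℙ
import Data.Parity.Properties as ℙ
open import Data.Product using (∃; _×_; _,_; proj₁; proj₂; uncurry)
open import Data.Sum using (_⊎_; inj₁; inj₂)
import Data.Sum as Sum
open import Function.Base using (case_of_; _∘_; id)
open import Function.Bundles using (Equivalence)
open import Relation.Binary.PropositionalEquality
  using (_≡_; _≢_; refl; sym; trans; cong; cong₂; subst; ≢-sym; module ≡-Reasoning)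
open import Relation.Nullary using (¬_; ¬?; _×-dec_; _→-dec_)
open import Relation.Nullary.Decidable using (Dec; yes; no; ⌊_⌋; toWitness)

open Equivalence using (to; from)

variable
  n : ℕ

⌊≟⌋-≡ : ∀ {x y : Fin n} → x ≡ y → ⌊ x ≟ y ⌋ ≡ true
⌊≟⌋-≡ {x = x} {y} x≡y with x ≟ y
... | yes _  = refl
... | no x≢y = ⊥-elim (x≢y x≡y)

⌊≟⌋-≢ : ∀ {x y : Fin n} → x ≢ y → ⌊ x ≟ y ⌋ ≡ false
⌊≟⌋-≢ {x = x} {y} x≢y with x ≟ y
... | yes x≡y = ⊥-elim (x≢y x≡y)
... | no _    = refl

inList⇒∈ : ∀ {x : Fin n} L → inList x L ≡ true → x ∈ L
inList⇒∈ {x = x} (y ∷ L) e with x ≟ y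
... | yes x≡y = here x≡y
... | no _    = there (inList⇒∈ L e)

∈⇒inList : ∀ {x : Fin n} {L} → x ∈ L → inList x L ≡ true
∈⇒inList (here x≡y)              = cong (_∨ _) (⌊≟⌋-≡ x≡y)
∈⇒inList {x = x} {y ∷ _} (there x∈L) with x ≟ y
... | yes _ = refl
... | no _  = ∈⇒inList x∈L

∉⇒inList : ∀ {x : Fin n} {L} → x ∉ L → inList x L ≡ false
∉⇒inList {x = x} {L} x∉L with inList x L in e
... | true  = ⊥-elim (x∉L (inList⇒∈ L e))
... | false = refl

⌊≟⌋-injective : ∀ {m} {f : Fin m → Fin n} → (∀ {x y} → f x ≡ f y → x ≡ y) →
                ∀ x y → ⌊ f x ≟ f y ⌋ ≡ ⌊ x ≟ y ⌋
⌊≟⌋-injective {f = f} f-inj x y with x ≟ y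
... | yes x≡y = ⌊≟⌋-≡ (cong f x≡y)
... | no x≢y  = ⌊≟⌋-≢ (λ e → x≢y (f-inj e))

inList-map : ∀ {m} {f : Fin m → Fin n} → (∀ {x y} → f x ≡ f y → x ≡ y) →
             ∀ x L → inList (f x) (map f L) ≡ inList x L
inList-map f-inj x []      = refl
inList-map f-inj x (y ∷ L) = cong₂ _∨_ (⌊≟⌋-injective f-inj x y) (inList-map f-inj x L)

Nbhd⇒adjacency : ∀ {A : Adj n} {u L} → Nbhd A u L → ∀ w → A u w ≡ inList w L
Nbhd⇒adjacency {A = A} {u} {L} nb w with A u w in e
... | true  = sym (∈⇒inList (to (nb w) e))
... | false = sym (∉⇒inList λ w∈L → case trans (sym e) (from (nb w) w∈L) of λ ())

lookup-injective : ∀ {a} {X : Set a} {xs : List X} → Unique xs →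
                   ∀ {i j} → lookup xs i ≡ lookup xs j → i ≡ j
lookup-injective (_ ∷ _)      {zero}  {zero}  _  = refl
lookup-injective (x∉xs ∷ _)   {zero}  {suc j} eq = ⊥-elim (All.lookup x∉xs (∈-lookup j) eq)
lookup-injective (x∉xs ∷ _)   {suc i} {zero}  eq = ⊥-elim (All.lookup x∉xs (∈-lookup i) (sym eq))
lookup-injective (_ ∷ unique) {suc i} {suc j} eq = cong suc (lookup-injective unique eq)

indicator : Bool → ℕ
indicator b = if b then 1 else 0

countᴸ : ∀ {a} {X : Set a} → (X → Bool) → List X → ℕ
countᴸ p []       = 0
countᴸ p (x ∷ xs) = indicator (p x) + countᴸ p xs

module _ {a} {X : Set a} where

  countᴸ-cong : ∀ {p q : X → Bool} → (∀ x → p x ≡ q x) →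
                ∀ xs → countᴸ p xs ≡ countᴸ q xs
  countᴸ-cong p≗q []       = refl
  countᴸ-cong p≗q (x ∷ xs) = cong₂ _+_ (cong indicator (p≗q x)) (countᴸ-cong p≗q xs)

  countᴸ-map : ∀ {b} {Y : Set b} (p : Y → Bool) (f : X → Y) xs →
               countᴸ p (map f xs) ≡ countᴸ (λ x → p (f x)) xs
  countᴸ-map p f []       = refl
  countᴸ-map p f (x ∷ xs) = cong (indicator (p (f x)) +_) (countᴸ-map p f xs)

  countᴸ-none : ∀ {p : X → Bool} xs → (∀ {x} → x ∈ xs → p x ≡ false) → countᴸ p xs ≡ 0
  countᴸ-none []       _    = refl
  countᴸ-none (x ∷ xs) none rewrite none (here refl) = countᴸ-none xs (λ m → none (there m))

count-cong : ∀ {p q : Fin n → Bool} → (∀ w → p w ≡ q w) → count p ≡ count q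
count-cong {zero}  p≗q = refl
count-cong {suc n} p≗q = cong₂ _+_ (cong indicator (p≗q zero)) (count-cong (λ w → p≗q (suc w)))

count-false : count {n} (λ _ → false) ≡ 0
count-false {zero}  = refl
count-false {suc n} = count-false {n}

count-split : ∀ (q p : Fin n → Bool) →
              count p ≡ count (λ w → not (q w) ∧ p w) + count (λ w → q w ∧ p w)
count-split {zero}  q p = refl
count-split {suc n} q p with q zero | p zero | count-split (λ w → q (suc w)) (λ w → p (suc w))
... | true  | true  | ih = trans (cong suc ih) (sym (+-suc _ _))
... | false | true  | ih = cong suc ih
... | true  | false | ih = ih
... | false | false | ih = ih

count-single : ∀ (y : Fin n) (f : Fin n → Bool) →
               count (λ w → ⌊ w ≟ y ⌋ ∧ f w) ≡ indicator (f y)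
count-single {suc n} zero    f = trans (cong (indicator (f zero) +_) (count-false {n})) (+-identityʳ _)
count-single {suc n} (suc y) f =
  trans (count-cong (λ w → cong (_∧ f (suc w)) (⌊≟⌋-injective suc-injective w y)))
        (count-single y (λ w → f (suc w)))

count-inList : ∀ {L : List (Fin n)} → Unique L →
               ∀ f → count (λ w → inList w L ∧ f w) ≡ countᴸ f L
count-inList {n} {L = []} _ f = count-false {n}
count-inList {L = y ∷ L} (y∉L ∷ unique) f = begin
  count (λ w → (⌊ w ≟ y ⌋ ∨ inList w L) ∧ f w)
    ≡⟨ count-split (λ w → ⌊ w ≟ y ⌋) _ ⟩
  count (λ w → not ⌊ w ≟ y ⌋ ∧ ((⌊ w ≟ y ⌋ ∨ inList w L) ∧ f w)) +
  count (λ w → ⌊ w ≟ y ⌋ ∧ ((⌊ w ≟ y ⌋ ∨ inList w L) ∧ f w))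
    ≡⟨ cong₂ _+_ (count-cong away-from-y) (count-cong at-y) ⟩
  count (λ w → inList w L ∧ f w) + count (λ w → ⌊ w ≟ y ⌋ ∧ f w)
    ≡⟨ cong₂ _+_ (count-inList unique f) (count-single y f) ⟩
  countᴸ f L + indicator (f y)
    ≡⟨ +-comm _ (indicator (f y)) ⟩
  indicator (f y) + countᴸ f L ∎
  where
  open ≡-Reasoning
  away-from-y : ∀ w → not ⌊ w ≟ y ⌋ ∧ ((⌊ w ≟ y ⌋ ∨ inList w L) ∧ f w) ≡ inList w L ∧ f w
  away-from-y w with w ≟ y
  ... | yes refl rewrite ∉⇒inList (All¬⇒¬Any y∉L) = refl
  ... | no _     = refl
  at-y : ∀ w → ⌊ w ≟ y ⌋ ∧ ((⌊ w ≟ y ⌋ ∨ inList w L) ∧ f w) ≡ ⌊ w ≟ y ⌋ ∧ f w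
  at-y w with w ≟ y
  ... | yes _ = refl
  ... | no _  = refl

paint : (R : List (Fin n)) → (Fin (length R) → Fin 5) → Coloring n → Coloring n
paint []      X φ w = φ w
paint (u ∷ R) X φ w = if ⌊ w ≟ u ⌋ then X zero else paint R (λ i → X (suc i)) φ w

paint-outside : ∀ (R : List (Fin n)) X φ {w} → inList w R ≡ false → paint R X φ w ≡ φ w
paint-outside []      X φ     _   = refl
paint-outside (u ∷ R) X φ {w} w∉R with w ≟ u | w∉R
... | no _ | w∉R′ = paint-outside R (λ i → X (suc i)) φ w∉R′

paint-lookup : ∀ {R : List (Fin n)} X φ → Unique R → ∀ i → paint R X φ (lookup R i) ≡ X i
paint-lookup {R = u ∷ R} X φ _ zero rewrite ⌊≟⌋-≡ (refl {x = u}) = refl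
paint-lookup {R = u ∷ R} X φ (u∉R ∷ unique) (suc i)
  rewrite ⌊≟⌋-≢ (≢-sym (All.lookup u∉R (∈-lookup i))) =
    paint-lookup (λ i → X (suc i)) φ unique i

parity≡1ℙ⇒%2≡1 : ∀ m → parity m ≡ 1ℙ → m % 2 ≡ 1
parity≡1ℙ⇒%2≡1 1             _ = refl
parity≡1ℙ⇒%2≡1 (suc (suc m)) p = parity≡1ℙ⇒%2≡1 m p

OddSum : ∀ {a} {C : Set a} → (C → ℕ) → (C → ℕ) → Set a
OddSum s m = ∃ λ j → parity (s j + m j) ≡ 1ℙ

ParityDiffers : ∀ {a} {C : Set a} → (C → ℕ) → (C → ℕ) → Set a
ParityDiffers m m′ = ∃ λ j → parity (m j) ≢ parity (m′ j)

oddSum-either : ∀ {a} {C : Set a} {m m′ : C → ℕ} → ParityDiffers m m′ →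
                ∀ s → OddSum s m ⊎ OddSum s m′
oddSum-either {m = m} {m′} (j , differs) s =
  Sum.map (λ odd → j , trans (ℙ.+-homo-+ (s j) (m j)) odd)
          (λ odd → j , trans (ℙ.+-homo-+ (s j) (m′ j)) odd)
          (+-one-of-1ℙ (parity (s j)) differs)
  where
  +-one-of-1ℙ : ∀ p {q q′} → q ≢ q′ → p ℙ.+ q ≡ 1ℙ ⊎ p ℙ.+ q′ ≡ 1ℙ
  +-one-of-1ℙ 0ℙ {1ℙ}       _   = inj₁ refl
  +-one-of-1ℙ 0ℙ {0ℙ} {1ℙ}  _   = inj₂ refl
  +-one-of-1ℙ 0ℙ {0ℙ} {0ℙ}  q≢q = ⊥-elim (q≢q refl)
  +-one-of-1ℙ 1ℙ {0ℙ}       _   = inj₁ refl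
  +-one-of-1ℙ 1ℙ {1ℙ} {0ℙ}  _   = inj₂ refl
  +-one-of-1ℙ 1ℙ {1ℙ} {1ℙ}  q≢q = ⊥-elim (q≢q refl)

-- Each of F and G fails for at most one of the three options.
common-of-three : ∀ {a b} {F : Fin 3 → Set a} {G : Fin 3 → Set b} →
                  (∀ o o′ → o ≢ o′ → F o ⊎ F o′) → (∀ o o′ → o ≢ o′ → G o ⊎ G o′) →
                  ∃ λ o → F o × G o
common-of-three F-pairs G-pairs with F-pairs 0F 1F (λ ()) | G-pairs 0F 1F (λ ())
... | inj₁ f₀ | inj₁ g₀ = 0F , f₀ , g₀
... | inj₂ f₁ | inj₂ g₁ = 1F , f₁ , g₁
... | inj₁ f₀ | inj₂ g₁ with F-pairs 1F 2F (λ ()) | G-pairs 0F 2F (λ ())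
...   | inj₁ f₁ | _       = 1F , f₁ , g₁
...   | inj₂ _  | inj₁ g₀ = 0F , f₀ , g₀
...   | inj₂ f₂ | inj₂ g₂ = 2F , f₂ , g₂
common-of-three F-pairs G-pairs | inj₂ f₁ | inj₁ g₀
  with F-pairs 0F 2F (λ ()) | G-pairs 1F 2F (λ ())
...   | inj₁ f₀ | _       = 0F , f₀ , g₀
...   | inj₂ _  | inj₁ g₁ = 1F , f₁ , g₁
...   | inj₂ f₂ | inj₂ g₂ = 2F , f₂ , g₂

≢-cover : ∀ {i k : Fin 3} → k ≢ i → k ≡ next i ⊎ k ≡ next (next i)
≢-cover {0F} {0F} k≢i = ⊥-elim (k≢i refl)
≢-cover {0F} {1F} _   = inj₁ refl
≢-cover {0F} {2F} _   = inj₂ refl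
≢-cover {1F} {0F} _   = inj₂ refl
≢-cover {1F} {1F} k≢i = ⊥-elim (k≢i refl)
≢-cover {1F} {2F} _   = inj₁ refl
≢-cover {2F} {0F} _   = inj₁ refl
≢-cover {2F} {1F} _   = inj₂ refl
≢-cover {2F} {2F} k≢i = ⊥-elim (k≢i refl)

≢-next-next : ∀ {i k : Fin 3} → k ≢ i → k ≢ next i → k ≡ next (next i)
≢-next-next k≢i k≢next = Sum.[ (λ k≡next → ⊥-elim (k≢next k≡next)) , id ]′ (≢-cover k≢i)

threeTree-symmetric : ∀ {A : Adj n} → IsThreeTree n A → ∀ x y → A x y ≡ A y x
threeTree-symmetric base x y = cong not (⌊≟⌋-sym x y)
  where
  ⌊≟⌋-sym : ∀ {n} (x y : Fin n) → ⌊ x ≟ y ⌋ ≡ ⌊ y ≟ x ⌋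
  ⌊≟⌋-sym x y with x ≟ y
  ... | yes x≡y = sym (⌊≟⌋-≡ (sym x≡y))
  ... | no x≢y  = sym (⌊≟⌋-≢ (≢-sym x≢y))
threeTree-symmetric (add t a b c _ _ _) zero    zero    = refl
threeTree-symmetric (add t a b c _ _ _) zero    (suc j) = refl
threeTree-symmetric (add t a b c _ _ _) (suc i) zero    = refl
threeTree-symmetric (add t a b c _ _ _) (suc i) (suc j) = threeTree-symmetric t i j
threeTree-symmetric (relabel t σ B≡Aσ) x y =
  trans (B≡Aσ x y) (trans (threeTree-symmetric t _ _) (sym (B≡Aσ y x)))

threeTree-noIsolated : ∀ {A : Adj n} → IsThreeTree n A → ∀ x → ∃ λ y → A x y ≡ true
threeTree-noIsolated base zero    = 1F , refl
threeTree-noIsolated base (suc x) = 0F , refl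
threeTree-noIsolated (add t a b c _ _ _) zero =
  suc a , cong (_∨ (⌊ a ≟ b ⌋ ∨ ⌊ a ≟ c ⌋)) (⌊≟⌋-≡ (refl {x = a}))
threeTree-noIsolated (add t a b c _ _ _) (suc x) with threeTree-noIsolated t x
... | y , xy = suc y , xy
threeTree-noIsolated {A = B} (relabel {A = A} t σ B≡Aσ) x with threeTree-noIsolated t (σ ⟨$⟩ʳ x)
... | y , xy =
  σ ⟨$⟩ˡ y , trans (B≡Aσ x _) (subst (λ z → A (σ ⟨$⟩ʳ x) z ≡ true) (sym (inverseʳ σ)) xy)

-- Local vertices of a branch with r vertices besides its triangle: 0F, 1F, 2F are v₁, v₂, v₃
-- and br i is the i-th vertex of u0 ∷ rest; P i lists the neighbours of br i.
Pattern : ℕ → Set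
Pattern r = Fin r → List (Fin (3 + r))

tri : ∀ {r} → Fin 3 → Fin (3 + r)
tri {r} k = k ↑ˡ r

br : ∀ {r} → Fin r → Fin (3 + r)
br i = 3 ↑ʳ i

colouring : ∀ {r} → Fin 5 → Fin 5 → Fin 5 → Vec (Fin 5) r → Fin (3 + r) → Fin 5
colouring a b c X = Vec.lookup (a ∷ b ∷ c ∷ X)

multiplicity : ∀ {l} → (Fin l → Fin 5) → List (Fin l) → Fin 5 → ℕ
multiplicity κ L j = countᴸ (λ x → ⌊ κ x ≟ j ⌋) L

Admissible : ∀ {r} → Pattern r → (Fin (3 + r) → Fin 5) → Set
Admissible P κ =
  ∀ i → All (λ x → κ x ≢ κ (br i)) (P i) × ∃ (λ j → parity (multiplicity κ (P i) j) ≡ 1ℙ)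

triangleMultiplicity : ∀ {r} → Pattern r → (Fin (3 + r) → Fin 5) → Fin 3 → Fin 5 → ℕ
triangleMultiplicity {r} P κ k j =
  countᴸ (λ i → inList (tri k) (P i) ∧ ⌊ κ (br i) ≟ j ⌋) (allFin r)

-- s k j stands for the number of neighbours of vₖ of colour j off the branch.
record Solution {r} (P : Pattern r) (a b c : Fin 5) (s : Fin 3 → Fin 5 → ℕ)
                (Fixed : Fin 3 → Set) : Set where
  constructor solution
  field
    colours    : Vec (Fin 5) r
    admissible : Admissible P (colouring a b c colours)
    fixes      : ∀ k → Fixed k → OddSum (s k) (triangleMultiplicity P (colouring a b c colours) k)

mapFixed : ∀ {r} {P : Pattern r} {a b c s} {F F′ : Fin 3 → Set} →
           (∀ k → F′ k → F k) → Solution P a b c s F → Solution P a b c s F′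
mapFixed F′⇒F (solution X admissible fixes) = solution X admissible (λ k → fixes k ∘ F′⇒F k)

module BranchExtension
  {n} {A : Adj n} (A-sym : ∀ x y → A x y ≡ A y x) (noIsolated : ∀ x → ∃ λ y → A x y ≡ true)
  {v : Fin 3 → Fin n} {u0 : Fin n} {rest : List (Fin n)} (branch : IsBranch A v u0 rest)
  {φ′ : Coloring n} (φ′-odd : OddColoring A (λ w → not (inList w (u0 ∷ rest))) φ′)
  where

  R : List (Fin n)
  R = u0 ∷ rest

  outside : Fin n → Bool
  outside w = not (inList w R)

  emb : Fin (3 + length R) → Fin n
  emb = lookup (v 0F ∷ v 1F ∷ v 2F ∷ R)

  emb-injective : ∀ {x y} → emb x ≡ emb y → x ≡ y
  emb-injective = lookup-injective (IsBranch.distinct branch)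

  emb-tri : ∀ k → emb (tri k) ≡ v k
  emb-tri 0F = refl
  emb-tri 1F = refl
  emb-tri 2F = refl

  R-unique : Unique R
  R-unique = Unique.drop⁺ 3 (IsBranch.distinct branch)

  v∉R : ∀ k → inList (v k) R ≡ false
  v∉R k = ∉⇒inList λ (vk∈R : v k ∈ R) →
    tri≢br k (emb-injective {tri k} {br (index vk∈R)} (trans (emb-tri k) (lookup-index vk∈R)))
    where
    tri≢br : ∀ k {i} → tri k ≢ br i
    tri≢br 0F ()
    tri≢br 1F ()
    tri≢br 2F ()

  a b c : Fin 5
  a = φ′ (v 0F)
  b = φ′ (v 1F)
  c = φ′ (v 2F)

  triangle-proper : ∀ {k l} → k ≢ l → φ′ (v k) ≢ φ′ (v l)
  triangle-proper {k} {l} k≢l = proj₁ φ′-odd (v k) (v l) (cong not (v∉R k)) (cong not (v∉R l))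
                                          (IsBranch.triangle branch k l k≢l)

  outerCount : Fin 3 → Fin 5 → ℕ
  outerCount k = nbColorCount A outside φ′ (v k)

  branch-closed : ∀ {u w} → inList u R ≡ true → A u w ≡ true → inList w (triList v) ≡ false →
                  inList w R ≡ true
  branch-closed {u} {w} u∈R uw w∉V = ∈⇒inList (to (IsBranch.component branch w)
    (step (from (IsBranch.component branch u) (inList⇒∈ R u∈R)) uw w∉V))

  off-triangle : ∀ {w} → ¬ (∃ λ k → w ≡ v k) → inList w (triList v) ≡ false
  off-triangle w∉V = ∉⇒inList {L = triList v} λ
    { (here w≡v₁)                 → w∉V (0F , w≡v₁)
    ; (there (here w≡v₂))         → w∉V (1F , w≡v₂)
    ; (there (there (here w≡v₃))) → w∉V (2F , w≡v₃) }

  module _ (P : Pattern (length R)) (P-unique : ∀ i → Unique (P i))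
           (realised : ∀ i → Nbhd A (lookup R i) (map emb (P i)))
           {Fixed : Fin 3 → Set} (sol : Solution P a b c outerCount Fixed) where

    open Solution sol

    κ : Fin (3 + length R) → Fin 5
    κ = colouring a b c colours

    φ : Coloring n
    φ = paint R (Vec.lookup colours) φ′

    φ-outside : ∀ {w} → inList w R ≡ false → φ w ≡ φ′ w
    φ-outside = paint-outside R (Vec.lookup colours) φ′

    φ-emb : ∀ x → φ (emb x) ≡ κ x
    φ-emb 0F                  = φ-outside (v∉R 0F)
    φ-emb 1F                  = φ-outside (v∉R 1F)
    φ-emb 2F                  = φ-outside (v∉R 2F)
    φ-emb (suc (suc (suc i))) = paint-lookup (Vec.lookup colours) φ′ R-unique i

    adjacency-tri-br : ∀ k i → A (v k) (lookup R i) ≡ inList (tri k) (P i)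
    adjacency-tri-br k i = begin
      A (v k) (lookup R i)                  ≡⟨ A-sym (v k) (lookup R i) ⟩
      A (lookup R i) (v k)                  ≡⟨ Nbhd⇒adjacency {A = A} (realised i) (v k) ⟩
      inList (v k) (map emb (P i))          ≡⟨ cong (λ w → inList w (map emb (P i))) (emb-tri k) ⟨
      inList (emb (tri k)) (map emb (P i))  ≡⟨ inList-map emb-injective (tri k) (P i) ⟩
      inList (tri k) (P i)                  ∎
      where open ≡-Reasoning

    count-decomposition : ∀ x j →
      nbColorCount A allV φ x j ≡ nbColorCount A outside φ′ x j + countᴸ (λ u → A x u ∧ ⌊ φ u ≟ j ⌋) R
    count-decomposition x j =
      trans (count-split (λ w → inList w R) (λ w → A x w ∧ ⌊ φ w ≟ j ⌋))
            (cong₂ _+_ (count-cong outside-part) (count-inList R-unique _))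
      where
      outside-part : ∀ w →
        not (inList w R) ∧ (A x w ∧ ⌊ φ w ≟ j ⌋) ≡ A x w ∧ outside w ∧ ⌊ φ′ w ≟ j ⌋
      outside-part w with inList w R in w∈R
      ... | true  = sym (∧-zeroʳ (A x w))
      ... | false rewrite φ-outside w∈R = refl

    odd-by-parity : ∀ {x} j → parity (nbColorCount A allV φ x j) ≡ 1ℙ → OddAt A allV φ x
    odd-by-parity {x} j odd = j , parity≡1ℙ⇒%2≡1 (nbColorCount A allV φ x j) odd

    odd-off-branch : ∀ x → inList x R ≡ false → inList x (triList v) ≡ false → OddAt A allV φ x
    odd-off-branch x x∉R x∉V = keep-odd (proj₂ φ′-odd x (cong not x∉R) neighbour-in-G′)
      where
      no-branch-neighbour : ∀ {u} → u ∈ R → A x u ≡ false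
      no-branch-neighbour {u} u∈R with A x u in xu
      ... | false = refl
      ... | true  = case trans (sym x∉R) (branch-closed (∈⇒inList u∈R) (trans (A-sym u x) xu) x∉V)
                    of λ ()

      neighbour-in-G′ : NonIsolated A outside x
      neighbour-in-G′ with noIsolated x
      ... | y , xy =
        y , cong not (∉⇒inList λ y∈R → case trans (sym xy) (no-branch-neighbour y∈R) of λ ()) , xy

      same-count : ∀ j → nbColorCount A allV φ x j ≡ nbColorCount A outside φ′ x j
      same-count j = trans (count-decomposition x j)
        (trans (cong (nbColorCount A outside φ′ x j +_)
                     (countᴸ-none R λ {u} u∈R →
                        cong (_∧ ⌊ φ u ≟ j ⌋) (no-branch-neighbour u∈R)))
               (+-identityʳ (nbColorCount A outside φ′ x j)))

      keep-odd : OddAt A outside φ′ x → OddAt A allV φ x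
      keep-odd (j , odd) = j , subst (λ m → m % 2 ≡ 1) (sym (same-count j)) odd

    odd-at-triangle : ∀ k → OddSum (outerCount k) (triangleMultiplicity P κ k) → OddAt A allV φ (v k)
    odd-at-triangle k (j , odd) = odd-by-parity j (trans (cong parity total) odd)
      where
      open ≡-Reasoning
      f : Fin n → Bool
      f u = A (v k) u ∧ ⌊ φ u ≟ j ⌋
      branch-part : countᴸ f R ≡ triangleMultiplicity P κ k j
      branch-part = begin
        countᴸ f R
          ≡⟨ cong (countᴸ f) (tabulate-lookup R) ⟨
        countᴸ f (tabulate (lookup R))
          ≡⟨ cong (countᴸ f) (map-tabulate id (lookup R)) ⟨
        countᴸ f (map (lookup R) (allFin _))
          ≡⟨ countᴸ-map f (lookup R) (allFin _) ⟩
        countᴸ (λ i → f (lookup R i)) (allFin _)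
          ≡⟨ countᴸ-cong (λ i → cong₂ _∧_ (adjacency-tri-br k i) (cong (λ c → ⌊ c ≟ j ⌋) (φ-emb (br i))))
                         (allFin _) ⟩
        triangleMultiplicity P κ k j
          ∎
      total : nbColorCount A allV φ (v k) j ≡ outerCount k j + triangleMultiplicity P κ k j
      total = trans (count-decomposition (v k) j) (cong (outerCount k j +_) branch-part)

    OddProperAt : Fin n → Set
    OddProperAt w = OddAt A allV φ w × (∀ y → A w y ≡ true → φ w ≢ φ y)

    odd-proper-at-branch : ∀ i → OddProperAt (lookup R i)
    odd-proper-at-branch i = odd , proper
      where
      open ≡-Reasoning
      u : Fin n
      u = lookup R i
      L : List (Fin n)
      L = map emb (P i)
      total : ∀ j → nbColorCount A allV φ u j ≡ multiplicity κ (P i) j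
      total j = begin
        count (λ w → A u w ∧ ⌊ φ w ≟ j ⌋)
          ≡⟨ count-cong (λ w → cong (_∧ ⌊ φ w ≟ j ⌋) (Nbhd⇒adjacency {A = A} (realised i) w)) ⟩
        count (λ w → inList w L ∧ ⌊ φ w ≟ j ⌋)
          ≡⟨ count-inList (Unique.map⁺ emb-injective (P-unique i)) _ ⟩
        countᴸ (λ w → ⌊ φ w ≟ j ⌋) L
          ≡⟨ countᴸ-map _ emb (P i) ⟩
        countᴸ (λ x → ⌊ φ (emb x) ≟ j ⌋) (P i)
          ≡⟨ countᴸ-cong (λ x → cong (λ c → ⌊ c ≟ j ⌋) (φ-emb x)) (P i) ⟩
        multiplicity κ (P i) j
          ∎
      odd : OddAt A allV φ u
      odd with proj₂ (admissible i)
      ... | j , odd = odd-by-parity j (trans (cong parity (total j)) odd)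
      proper : ∀ y → A u y ≡ true → φ u ≢ φ y
      proper y uy φu≡φy with ∈-map⁻ emb (to (realised i y) uy)
      ... | x , x∈P , refl =
        All.lookup (proj₁ (admissible i)) x∈P
          (trans (sym (φ-emb x)) (trans (sym φu≡φy) (φ-emb (br i))))

    odd-proper-in-branch : ∀ {w} → inList w R ≡ true → OddProperAt w
    odd-proper-in-branch {w} w∈R with inList⇒∈ R w∈R
    ... | w∈R′ rewrite lookup-index w∈R′ = odd-proper-at-branch (index w∈R′)

    φ-proper : Proper A allV φ
    φ-proper x y _ _ xy with inList x R in x∈R | inList y R in y∈R
    ... | true  | _     = proj₂ (odd-proper-in-branch x∈R) y xy
    ... | false | true  = ≢-sym (proj₂ (odd-proper-in-branch y∈R) x (trans (A-sym y x) xy))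
    ... | false | false = λ φx≡φy → proj₁ φ′-odd x y (cong not x∈R) (cong not y∈R) xy
                                       (trans (sym (φ-outside x∈R)) (trans φx≡φy (φ-outside y∈R)))

    φ-odd : ∀ w → (∀ k → w ≡ v k → Fixed k) → OddAt A allV φ w
    φ-odd w fixed with inList w R in w∈R
    ... | true  = proj₁ (odd-proper-in-branch w∈R)
    ... | false with Fin.any? (λ k → w ≟ v k)
    ...   | yes (k , refl) = odd-at-triangle k (fixes k (fixed k refl))
    ...   | no w∉V = odd-off-branch w w∈R (off-triangle w∉V)

    extension : ∃ λ φ → Extends outside φ′ φ × Proper A allV φ ×
                        (∀ w → (∀ k → w ≡ v k → Fixed k) → OddAt A allV φ w)
    extension = φ , (λ w w∉R → φ-outside (not-injective w∉R)) , φ-proper , φ-odd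

  index-≢ : ∀ {w i k} → w ≢ v i → w ≡ v k → k ≢ i
  index-≢ w≢vi refl refl = w≢vi refl

  a≢b : a ≢ b
  a≢b = triangle-proper {0F} {1F} (λ ())
  a≢c : a ≢ c
  a≢c = triangle-proper {0F} {2F} (λ ())
  b≢c : b ≢ c
  b≢c = triangle-proper {1F} {2F} (λ ())

  module _ (P : Pattern (length R)) (P-unique : ∀ i → Unique (P i))
           (realised : ∀ i → Nbhd A (lookup R i) (map emb (P i))) {i : Fin 3} where

    extension-except-two : Solution P a b c outerCount (λ k → k ≢ i × k ≢ next i) →
      ∃ λ φ → Extends outside φ′ φ × Proper A allV φ ×
              (∀ w → w ≢ v i → w ≢ v (next i) → OddAt A allV φ w)
    extension-except-two sol with extension P P-unique realised sol
    ... | φ , extends , proper , odd =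
      φ , extends , proper ,
      λ w w≢vi w≢vi′ → odd w λ k w≡vk → index-≢ w≢vi w≡vk , index-≢ w≢vi′ w≡vk

    extension-except-one : Solution P a b c outerCount (_≢ i) →
      ∃ λ φ → Extends outside φ′ φ × Proper A allV φ × (∀ w → w ≢ v i → OddAt A allV φ w)
    extension-except-one sol with extension P P-unique realised sol
    ... | φ , extends , proper , odd =
      φ , extends , proper , λ w w≢vi → odd w λ k → index-≢ w≢vi

admissible? : ∀ {r} (P : Pattern r) κ → Dec (Admissible P κ)
admissible? P κ = Fin.all? λ i →
  All.all? (λ x → ¬? (κ x ≟ κ (br i))) (P i) ×-dec
  Fin.any? (λ j → parity (multiplicity κ (P i) j) ℙ.≟ 1ℙ)

Distinguishes : ∀ {r} → Pattern r → (κ κ′ : Fin (3 + r) → Fin 5) → Fin 3 → Set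
Distinguishes P κ κ′ k = ParityDiffers (triangleMultiplicity P κ k) (triangleMultiplicity P κ′ k)

distinguishes? : ∀ {r} (P : Pattern r) κ κ′ k → Dec (Distinguishes P κ κ′ k)
distinguishes? P κ κ′ k = Fin.any? λ j →
  ¬? (parity (triangleMultiplicity P κ k j) ℙ.≟ parity (triangleMultiplicity P κ′ k j))

forDistinct? : ∀ {Q : Fin 5 → Fin 5 → Fin 5 → Set} → (∀ a b c → Dec (Q a b c)) →
               Dec (∀ a b c → a ≢ b → a ≢ c → b ≢ c → Q a b c)
forDistinct? Q? = Fin.all? λ a → Fin.all? λ b → Fin.all? λ c →
  ¬? (a ≟ b) →-dec ¬? (a ≟ c) →-dec ¬? (b ≟ c) →-dec Q? a b c

pattern-unique? : ∀ {r} (P : Pattern r) → Dec (∀ i → Unique (P i))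
pattern-unique? P = Fin.all? λ i → AllPairs.allPairs? (λ x y → ¬? (x ≟ y)) (P i)

-- Junk value 0F when C contains every colour.
freeColour : List (Fin 5) → Fin 5
freeColour C = foldr (λ j other → if inList j C then other else j) 0F (allFin 5)

fourth fifth : Fin 5 → Fin 5 → Fin 5 → Fin 5
fourth a b c = freeColour (a ∷ b ∷ c ∷ [])
fifth  a b c = freeColour (a ∷ b ∷ c ∷ fourth a b c ∷ [])

solution-of-three : ∀ {r} {P : Pattern r} {a b c} (options : Fin 3 → Vec (Fin 5) r) →
  let κ = λ o → colouring a b c (options o) in
  (∀ o → Admissible P (κ o)) → ∀ {k l} →
  (∀ o o′ → o ≢ o′ → Distinguishes P (κ o) (κ o′) k) →
  (∀ o o′ → o ≢ o′ → Distinguishes P (κ o) (κ o′) l) →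
  ∀ s → Solution P a b c s (λ m → m ≡ k ⊎ m ≡ l)
solution-of-three options admissible {k} {l} k-distinguished l-distinguished s
  with common-of-three (λ o o′ o≢o′ → oddSum-either (k-distinguished o o′ o≢o′) (s k))
                       (λ o o′ o≢o′ → oddSum-either (l-distinguished o o′ o≢o′) (s l))
... | o , odd-k , odd-l =
  solution (options o) (admissible o) λ { _ (inj₁ refl) → odd-k ; _ (inj₂ refl) → odd-l }

earPattern : Pattern 1
earPattern 0F = 0F ∷ 1F ∷ 2F ∷ []

earPattern-unique : ∀ i → Unique (earPattern i)
earPattern-unique = toWitness {a? = pattern-unique? earPattern} _

earColours : Fin 5 → Fin 5 → Fin 5 → Fin 2 → Vec (Fin 5) 1
earColours a b c 0F = fourth a b c ∷ []
earColours a b c 1F = fifth a b c ∷ []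

earColouring : Fin 5 → Fin 5 → Fin 5 → Fin 2 → Fin 4 → Fin 5
earColouring a b c o = colouring a b c (earColours a b c o)

EarFacts : Fin 5 → Fin 5 → Fin 5 → Set
EarFacts a b c = (∀ o → Admissible earPattern (earColouring a b c o)) ×
                 (∀ k → Distinguishes earPattern (earColouring a b c 0F) (earColouring a b c 1F) k)

earFacts : ∀ a b c → a ≢ b → a ≢ c → b ≢ c → EarFacts a b c
earFacts = toWitness {a? = forDistinct? λ a b c →
  Fin.all? (λ o → admissible? earPattern (earColouring a b c o)) ×-dec
  Fin.all? (distinguishes? earPattern (earColouring a b c 0F) (earColouring a b c 1F))} _

earSolution : ∀ {a b c} → a ≢ b → a ≢ c → b ≢ c → ∀ s k →
              Solution earPattern a b c s (_≡ k)
earSolution {a} {b} {c} a≢b a≢c b≢c s k = from-facts (earFacts a b c a≢b a≢c b≢c)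
  where
  from-facts : EarFacts a b c → Solution earPattern a b c s (_≡ k)
  from-facts (admissible , distinguished) =
    Sum.[ choose 0F , choose 1F ]′ (oddSum-either (distinguished k) (s k))
    where
    choose : ∀ o → OddSum (s k) (triangleMultiplicity earPattern (earColouring a b c o) k) →
             Solution earPattern a b c s (_≡ k)
    choose o odd = solution (earColours a b c o) (admissible o) λ { _ refl → odd }

oneHatPattern : Pattern 2
oneHatPattern 0F = 0F ∷ 1F ∷ 2F ∷ 4F ∷ []
oneHatPattern 1F = 0F ∷ 1F ∷ 3F ∷ []

oneHatPattern-unique : ∀ i → Unique (oneHatPattern i)
oneHatPattern-unique = toWitness {a? = pattern-unique? oneHatPattern} _

oneHatColours : Fin 5 → Fin 5 → Fin 5 → Fin 2 → Fin 2 → Vec (Fin 5) 2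
oneHatColours a b c 0F 0F = fourth a b c ∷ c ∷ []
oneHatColours a b c 0F 1F = fourth a b c ∷ fifth a b c ∷ []
oneHatColours a b c 1F 0F = fifth a b c ∷ c ∷ []
oneHatColours a b c 1F 1F = fifth a b c ∷ fourth a b c ∷ []

oneHatColouring : Fin 5 → Fin 5 → Fin 5 → Fin 2 → Fin 2 → Fin 5 → Fin 5
oneHatColouring a b c p q = colouring a b c (oneHatColours a b c p q)

oneHatTriple : Fin 5 → Fin 5 → Fin 5 → Fin 3 → Vec (Fin 5) 2
oneHatTriple a b c 0F = oneHatColours a b c 0F 0F
oneHatTriple a b c 1F = oneHatColours a b c 0F 1F
oneHatTriple a b c 2F = oneHatColours a b c 1F 0F

oneHatTripleColouring : Fin 5 → Fin 5 → Fin 5 → Fin 3 → Fin 5 → Fin 5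
oneHatTripleColouring a b c o = colouring a b c (oneHatTriple a b c o)

OneHatFacts : Fin 5 → Fin 5 → Fin 5 → Set
OneHatFacts a b c =
  (∀ p q → Admissible oneHatPattern (κ p q)) ×
  (∀ q q′ → Distinguishes oneHatPattern (κ 0F q) (κ 1F q′) 2F) ×
  (∀ k → k ≢ 2F → ∀ p → Distinguishes oneHatPattern (κ p 0F) (κ p 1F) k) ×
  (∀ k → k ≢ 2F → ∀ o o′ → o ≢ o′ → Distinguishes oneHatPattern (κ₃ o) (κ₃ o′) k)
  where
  κ : Fin 2 → Fin 2 → Fin 5 → Fin 5
  κ = oneHatColouring a b c
  κ₃ : Fin 3 → Fin 5 → Fin 5
  κ₃ = oneHatTripleColouring a b c

oneHatFacts : ∀ a b c → a ≢ b → a ≢ c → b ≢ c → OneHatFacts a b c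
oneHatFacts = toWitness {a? = forDistinct? λ a b c →
  Fin.all? (λ p → Fin.all? λ q → admissible? oneHatPattern (oneHatColouring a b c p q)) ×-dec
  Fin.all? (λ q → Fin.all? λ q′ →
    distinguishes? oneHatPattern (oneHatColouring a b c 0F q) (oneHatColouring a b c 1F q′) 2F) ×-dec
  Fin.all? (λ k → ¬? (k ≟ 2F) →-dec Fin.all? λ p →
    distinguishes? oneHatPattern (oneHatColouring a b c p 0F) (oneHatColouring a b c p 1F) k) ×-dec
  Fin.all? (λ k → ¬? (k ≟ 2F) →-dec Fin.all? λ o → Fin.all? λ o′ → ¬? (o ≟ o′) →-dec
    distinguishes? oneHatPattern (oneHatTripleColouring a b c o) (oneHatTripleColouring a b c o′) k)} _

-- v₃ sees only u₀, whose colour is fourth or fifth, so no three options separate v₃.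
oneHatSolution-with-v₃ : ∀ {a b c} → OneHatFacts a b c → ∀ s k → k ≢ 2F →
                         Solution oneHatPattern a b c s (λ m → m ≡ k ⊎ m ≡ 2F)
oneHatSolution-with-v₃ {a} {b} {c} (admissible , v₃-distinguished , distinguished , _) s k k≢2F =
  Sum.[ fix-v₃ 0F , fix-v₃ 1F ]′
    (oddSum-either (v₃-distinguished (proj₁ (fix-k 0F)) (proj₁ (fix-k 1F))) (s 2F))
  where
  odd-at : Fin 3 → Fin 2 → Fin 2 → Set
  odd-at k p q = OddSum (s k) (triangleMultiplicity oneHatPattern (oneHatColouring a b c p q) k)
  fix-k : ∀ p → ∃ (odd-at k p)
  fix-k p = Sum.[ (0F ,_) , (1F ,_) ]′ (oddSum-either (distinguished k k≢2F p) (s k))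
  fix-v₃ : ∀ p → odd-at 2F p (proj₁ (fix-k p)) →
           Solution oneHatPattern a b c s (λ m → m ≡ k ⊎ m ≡ 2F)
  fix-v₃ p odd₃ = solution (oneHatColours a b c p (proj₁ (fix-k p))) (admissible p _)
    λ { _ (inj₁ refl) → proj₂ (fix-k p) ; _ (inj₂ refl) → odd₃ }

oneHatSolution : ∀ {a b c} → a ≢ b → a ≢ c → b ≢ c → ∀ s i →
                 Solution oneHatPattern a b c s (_≢ i)
oneHatSolution {a} {b} {c} a≢b a≢c b≢c s = from-facts (oneHatFacts a b c a≢b a≢c b≢c)
  where
  from-facts : OneHatFacts a b c → ∀ i → Solution oneHatPattern a b c s (_≢ i)
  from-facts facts 0F = mapFixed (λ _ → ≢-cover) (oneHatSolution-with-v₃ facts s 1F (λ ()))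
  from-facts facts 1F =
    mapFixed (λ _ → Sum.swap ∘ ≢-cover) (oneHatSolution-with-v₃ facts s 0F (λ ()))
  from-facts (admissible , _ , _ , distinguished) 2F =
    mapFixed (λ _ → ≢-cover) (solution-of-three (oneHatTriple a b c) triple-admissible
                                                (distinguished 0F (λ ())) (distinguished 1F (λ ())) s)
    where
    triple-admissible : ∀ o → Admissible oneHatPattern (oneHatTripleColouring a b c o)
    triple-admissible 0F = admissible 0F 0F
    triple-admissible 1F = admissible 0F 1F
    triple-admissible 2F = admissible 1F 0F

oneHatPlusPattern : Pattern 4
oneHatPlusPattern 0F = 0F ∷ 1F ∷ 2F ∷ 4F ∷ 5F ∷ 6F ∷ []
oneHatPlusPattern 1F = 0F ∷ 1F ∷ 3F ∷ 6F ∷ []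
oneHatPlusPattern 2F = 1F ∷ 2F ∷ 3F ∷ []
oneHatPlusPattern 3F = 0F ∷ 3F ∷ 4F ∷ []

oneHatPlusPattern-unique : ∀ i → Unique (oneHatPlusPattern i)
oneHatPlusPattern-unique = toWitness {a? = pattern-unique? oneHatPlusPattern} _

oneHatPlusColours : Fin 5 → Fin 5 → Fin 5 → Fin 3 → Vec (Fin 5) 4
oneHatPlusColours a b c 0F = fourth a b c ∷ c ∷ fifth a b c ∷ b ∷ []
oneHatPlusColours a b c 1F = fourth a b c ∷ fifth a b c ∷ a ∷ b ∷ []
oneHatPlusColours a b c 2F = fifth a b c ∷ c ∷ a ∷ fourth a b c ∷ []

oneHatPlusColouring : Fin 5 → Fin 5 → Fin 5 → Fin 3 → Fin 7 → Fin 5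
oneHatPlusColouring a b c o = colouring a b c (oneHatPlusColours a b c o)

OneHatPlusFacts : Fin 5 → Fin 5 → Fin 5 → Set
OneHatPlusFacts a b c =
  (∀ o → Admissible oneHatPlusPattern (oneHatPlusColouring a b c o)) ×
  (∀ k o o′ → o ≢ o′ →
     Distinguishes oneHatPlusPattern (oneHatPlusColouring a b c o) (oneHatPlusColouring a b c o′) k)

oneHatPlusFacts : ∀ a b c → a ≢ b → a ≢ c → b ≢ c → OneHatPlusFacts a b c
oneHatPlusFacts = toWitness {a? = forDistinct? λ a b c →
  Fin.all? (λ o → admissible? oneHatPlusPattern (oneHatPlusColouring a b c o)) ×-dec
  Fin.all? (λ k → Fin.all? λ o → Fin.all? λ o′ → ¬? (o ≟ o′) →-dec
    distinguishes? oneHatPlusPattern (oneHatPlusColouring a b c o) (oneHatPlusColouring a b c o′) k)} _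

oneHatPlusSolution : ∀ {a b c} → a ≢ b → a ≢ c → b ≢ c → ∀ s i →
                     Solution oneHatPlusPattern a b c s (_≢ i)
oneHatPlusSolution {a} {b} {c} a≢b a≢c b≢c s i = from-facts (oneHatPlusFacts a b c a≢b a≢c b≢c)
  where
  from-facts : OneHatPlusFacts a b c → Solution oneHatPlusPattern a b c s (_≢ i)
  from-facts (admissible , distinguished) =
    mapFixed (λ _ → ≢-cover) (solution-of-three (oneHatPlusColours a b c) admissible
                                                (distinguished (next i)) (distinguished (next (next i))) s)

lemma3p4 : (n : ℕ) (A : Adj n) → IsThreeTree n A →
           (v : Fin 3 → Fin n) (u0 : Fin n) (rest : List (Fin n)) (k : Kind) →
           IsBranch A v u0 rest → Shape A v u0 rest k →
           (φ' : Coloring n) →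
           OddColoring A (λ w → not (inList w (u0 ∷ rest))) φ' →
           (∀ (i : Fin 3) → ∃ λ (φ : Coloring n) →
               Extends (λ w → not (inList w (u0 ∷ rest))) φ' φ × Proper A allV φ ×
               (∀ w → w ≢ v i → w ≢ v (next i) → OddAt A allV φ w))
           × (k ≢ ear → ∀ (i : Fin 3) → ∃ λ (φ : Coloring n) →
               Extends (λ w → not (inList w (u0 ∷ rest))) φ' φ × Proper A allV φ ×
               (∀ w → w ≢ v i → OddAt A allV φ w))
lemma3p4 n A t v u0 rest k br (isEar nb) φ′ φ′-odd =
    (λ i → extension-except-two earPattern earPattern-unique (λ { 0F → nb }) (localSolution i))
  , (λ ear≢ear → ⊥-elim (ear≢ear refl))
  where
  open BranchExtension (threeTree-symmetric t) (threeTree-noIsolated t) br φ′-odd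
  localSolution : ∀ i → Solution earPattern a b c outerCount (λ k → k ≢ i × k ≢ next i)
  localSolution i =
    mapFixed (λ _ → uncurry ≢-next-next) (earSolution a≢b a≢c b≢c outerCount (next (next i)))
lemma3p4 n A t v u0 rest k br (isOneHat u1 nb₀ nb₁) φ′ φ′-odd =
    (λ i → extension-except-two P P-unique realised (mapFixed (λ _ → proj₁) (localSolution i)))
  , (λ _ i → extension-except-one P P-unique realised (localSolution i))
  where
  open BranchExtension (threeTree-symmetric t) (threeTree-noIsolated t) br φ′-odd
  P : Pattern 2
  P = oneHatPattern
  P-unique : ∀ i → Unique (P i)
  P-unique = oneHatPattern-unique
  realised : ∀ i → Nbhd A (lookup R i) (map emb (P i))
  realised 0F = nb₀
  realised 1F = nb₁
  localSolution : ∀ i → Solution P a b c outerCount (_≢ i)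
  localSolution = oneHatSolution a≢b a≢c b≢c outerCount
lemma3p4 n A t v u0 rest k br (isOneHatPlus u1 u2 u3 nb₀ nb₁ nb₂ nb₃) φ′ φ′-odd =
    (λ i → extension-except-two P P-unique realised (mapFixed (λ _ → proj₁) (localSolution i)))
  , (λ _ i → extension-except-one P P-unique realised (localSolution i))
  where
  open BranchExtension (threeTree-symmetric t) (threeTree-noIsolated t) br φ′-odd
  P : Pattern 4
  P = oneHatPlusPattern
  P-unique : ∀ i → Unique (P i)
  P-unique = oneHatPlusPattern-unique
  realised : ∀ i → Nbhd A (lookup R i) (map emb (P i))
  realised 0F = nb₀
  realised 1F = nb₁
  realised 2F = nb₂
  realised 3F = nb₃
  localSolution : ∀ i → Solution P a b c outerCount (_≢ i)
  localSolution = oneHatPlusSolution a≢b a≢c b≢c outerCount
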